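{- Let $n\ge1$ and let $\pi$ range over the trajectories associated to the vertices $\varepsilon_1\otimes\cdots\otimes\varepsilon_n\in B^{\otimes n}$. (1) For every $\pi$, $D(\mathcal P_{\min}(\pi))=D(\pi)$. (2) For every nonnegative trajectory $\pi$ (i.e. $\pi(k)\ge0$ for all $0\le k\le n$), $D(\mathrm{pr}(\pi))=D(\pi)-\pi_-$, where $\pi_-$ is the number of steps $-1$ of $\pi$. (3) For every $\pi$, there exists an integer $m_0$ such that $\mathcal P_{\max}^{(m)}(\pi)=\pi_0$ for all $m\ge m_0$, where $\mathcal P_{\max}^{(m)}$ is the $m$-th iterate of $\mathcal P_{\max}$ and $\pi_0$ is the trajectory all of whose steps equal $+1$.
   Context: $B$ is the type $A_1^{(1)}$ Kirillov–Reshetikhin crystal with vertices $1,2$. A vertex $\varepsilon_1\otimes\cdots\otimes\varepsilon_n\in B^{\otimes n}$ ($\varepsilon_k\in\{1,2\}$) is identified with the trajectory $\pi:\{0,\dots,n\}\to\mathbb Z$, $\pi(k)=\pi_+(k)-\pi_-(k)$, where $\pi_+(k)$ (resp. $\pi_-(k)$) is the number of letters $1$ (resp. $2$) among $\varepsilon_1,\dots,\varepsilon_k$; so $\pi(0)=0$ and letter $1$ is a step $+1$, letter $2$ a step $-1$. Pitman transforms: $\mathcal P_{\min}(\pi)(k)=\pi(k)-2\min_{0\le a\le k}\pi(a)$ and $\mathcal P_{\max}(\pi)(k)=2\max_{0\le a\le k}\pi(a)-\pi(k)$ for $0\le k\le n$ (these are again trajectories with steps $\pm1$). Promotion $\mathrm{pr}$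 exchanges the letters $1$ and $2$, i.e. $\mathrm{pr}(\pi)(k)=-\pi(k)$. The energy on $B^{\otimes n}$ is $D(\varepsilon_1\otimes\cdots\otimes\varepsilon_n)=\sum_{i=1}^{n-1}(n-i)\,H(\varepsilon_i\otimes\varepsilon_{i+1})$ where $H(\varepsilon_i\otimes\varepsilon_{i+1})=1$ if $\varepsilon_i=1$ and $\varepsilon_{i+1}=2$, and $0$ otherwise. -}

module Defs where

open import Data.Nat using (ℕ; zero; suc; _+_; _*_)
open import Data.Integer as ℤ using (ℤ; +_; -[1+_]; _-_; _<?_)
open import Data.Fin using (Fin; toℕ)
open import Data.Vec using (Vec; []; _∷_; tabulate; toList; map)
open import Data.List as List using (List; take)
open import Relation.Nullary using (does)
open import Data.Bool using (if_then_else_)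

-- Vertices of the A_1^(1) KR crystal B
data Letter : Set where
  one two : Letter

Word : ℕ → Set
Word n = Vec Letter n

step : Letter → ℤ
step one = + 1
step two = -[1+ 0 ]

sumℤ : List ℤ → ℤ
sumℤ = List.foldr ℤ._+_ (+ 0)

-- the trajectory π(k) = π₊(k) - π₋(k) (meaningful for 0 ≤ k ≤ n)
traj : ∀ {n} → Word n → ℕ → ℤ
traj w k = sumℤ (List.map step (take k (toList w)))

minUpTo : (ℕ → ℤ) → ℕ → ℤ
minUpTo f zero = f zero
minUpTo f (suc k) = minUpTo f k ℤ.⊓ f (suc k)

maxUpTo : (ℕ → ℤ) → ℕ → ℤ
maxUpTo f zero = f zero
maxUpTo f (suc k) = maxUpTo f k ℤ.⊔ f (suc k)

PminTraj : (ℕ → ℤ) → ℕ → ℤ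
PminTraj f k = f k - (+ 2) ℤ.* minUpTo f k

PmaxTraj : (ℕ → ℤ) → ℕ → ℤ
PmaxTraj f k = (+ 2) ℤ.* maxUpTo f k - f k

wordOf : (n : ℕ) → (ℕ → ℤ) → Word n
wordOf n f = tabulate λ (i : Fin n) →
  if does (f (toℕ i) <? f (suc (toℕ i))) then one else two

Pmin : ∀ {n} → Word n → Word n
Pmin {n} w = wordOf n (PminTraj (traj w))

Pmax : ∀ {n} → Word n → Word n
Pmax {n} w = wordOf n (PmaxTraj (traj w))

swapL : Letter → Letter
swapL one = two
swapL two = one

pr : ∀ {n} → Word n → Word n
pr = map swapL

H : Letter → Letter → ℕ
H one two = 1
H _ _ = 0

-- energy D(ε₁⊗⋯⊗εₙ) = Σ_{i=1}^{n-1} (n-i) H(εᵢ⊗εᵢ₊₁),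
-- computed recursively: the first term has weight n-1 = 1 + length of the tail after ε₂
D : ∀ {n} → Word n → ℕ
D [] = 0
D (x ∷ []) = 0
D {suc (suc m)} (x ∷ y ∷ r) = (suc m) * H x y + D (y ∷ r)

countMinus : ∀ {n} → Word n → ℕ
countMinus [] = 0
countMinus (one ∷ r) = countMinus r
countMinus (two ∷ r) = suc (countMinus r)

iter : ∀ {A : Set} → ℕ → (A → A) → A → A
iter zero f x = x
iter (suc m) f x = f (iter m f x)

allOne : (n : ℕ) → Word n
allOne n = Data.Vec.replicate n one

-- 𝒫_min acts on words as a letter-by-letter transducer whose state is the
-- height d of the path above its running minimum: a step -1 taken at height 0
-- becomes +1 and every other step is kept.  The transducer preserves each
-- local energy H(εᵢ ⊗ εᵢ₊₁), which gives (1).  Since max π = -min(-π), we have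
-- 𝒫_max = 𝒫_min ∘ pr, so 𝒫_max turns a word beginning with k letters 1 into
-- one beginning with k + 1 letters 1, which gives (3) with m₀ = n.  For (2),
-- H(εᵢ ⊗ εᵢ₊₁) - H(pr εᵢ ⊗ pr εᵢ₊₁) = [εᵢ₊₁ = 2] - [εᵢ = 2], so D - D ∘ pr
-- telescopes to π₋ - n [ε₁ = 2], and a nonnegative path starts with the letter 1.

module Submission where

open import Defs
open import Data.Nat using (ℕ; _≤_; _+_)
open import Data.Integer using (+_) renaming (_≤_ to _≤ℤ_)
open import Data.Product using (_×_; ∃)
open import Relation.Binary.PropositionalEquality using (_≡_)

open import Data.Nat using (zero; suc; _*_; z≤n; s≤s)
import Data.Nat.Properties as ℕₚ
open import Data.Nat.Tactic.RingSolver as ℕ-Solver using ()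
open import Data.Integer as ℤ using (ℤ; -_; _-_; _⊓_; _<?_)
import Data.Integer.Properties as ℤₚ
open import Data.Integer.Tactic.RingSolver as ℤ-Solver using ()
open import Data.Vec using ([]; _∷_)
open import Data.Product using (_,_)
open import Data.Unit using (⊤; tt)
open import Data.Bool using (if_then_else_)
open import Function using (_∘_)
open import Relation.Nullary using (does)
open import Relation.Nullary.Decidable using (dec-true; dec-false)
open import Relation.Binary.PropositionalEquality using (refl; sym; trans; cong; cong₂; subst; module ≡-Reasoning)

letterOf-step : ∀ {a b} x → b ≡ step x ℤ.+ a → (if does (a <? b) then one else two) ≡ x
letterOf-step {a} one refl
  rewrite dec-true (a <? + 1 ℤ.+ a) (ℤₚ.suc[i]≤j⇒i<j ℤₚ.≤-refl) = refl
letterOf-step {a} two refl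
  rewrite dec-false (a <? ℤ.pred a) (ℤₚ.<-asym (ℤₚ.suc[i]≤j⇒i<j (ℤₚ.≤-reflexive (ℤₚ.suc-pred a)))) = refl

wordOf-traj : ∀ {n} (v : Word n) c g → (∀ k → g k ≡ c ℤ.+ traj v k) → wordOf n g ≡ v
wordOf-traj []      c g g≡ = refl
wordOf-traj (x ∷ v) c g g≡ = cong₂ _∷_ (letterOf-step x g₁≡) (wordOf-traj v (c ℤ.+ step x) (g ∘ suc) g∘suc≡)
  where
  swap : ∀ c s → c ℤ.+ (s ℤ.+ + 0) ≡ s ℤ.+ (c ℤ.+ + 0)
  swap = ℤ-Solver.solve-∀
  g₁≡ : g 1 ≡ step x ℤ.+ g 0
  g₁≡ = trans (g≡ 1) (trans (swap c (step x)) (cong (ℤ._+_ (step x)) (sym (g≡ 0))))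
  g∘suc≡ : ∀ k → g (suc k) ≡ c ℤ.+ step x ℤ.+ traj v k
  g∘suc≡ k = trans (g≡ (suc k)) (sym (ℤₚ.+-assoc c (step x) (traj v k)))

traj-[] : ∀ k → traj [] k ≡ + 0
traj-[] zero    = refl
traj-[] (suc k) = refl

step-swapL : ∀ x → step (swapL x) ≡ - step x
step-swapL one = refl
step-swapL two = refl

traj-pr : ∀ {n} (w : Word n) k → traj (pr w) k ≡ - traj w k
traj-pr []      zero    = refl
traj-pr []      (suc k) = refl
traj-pr (x ∷ w) zero    = refl
traj-pr (x ∷ w) (suc k) =
  trans (cong₂ ℤ._+_ (step-swapL x) (traj-pr w k)) (sym (ℤₚ.neg-distrib-+ (step x) (traj w k)))

minUpTo-suc : ∀ f k → minUpTo f (suc k) ≡ f 0 ⊓ minUpTo (f ∘ suc) k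
minUpTo-suc f zero    = refl
minUpTo-suc f (suc k) =
  trans (cong (_⊓ f (suc (suc k))) (minUpTo-suc f k)) (ℤₚ.⊓-assoc (f 0) _ _)

minUpTo≤head : ∀ f k → minUpTo f k ≤ℤ f 0
minUpTo≤head f zero    = ℤₚ.≤-refl
minUpTo≤head f (suc k) = ℤₚ.≤-trans (ℤₚ.i⊓j≤i _ _) (minUpTo≤head f k)

minUpTo-neg : ∀ f g → (∀ j → g j ≡ - f j) → ∀ k → minUpTo g k ≡ - maxUpTo f k
minUpTo-neg f g g≡ zero    = g≡ 0
minUpTo-neg f g g≡ (suc k) =
  trans (cong₂ _⊓_ (minUpTo-neg f g g≡ k) (g≡ (suc k)))
        (sym (ℤₚ.neg-distrib-⊔-⊓ (maxUpTo f k) (f (suc k))))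

PmaxTraj≡PminTraj-neg : ∀ f g → (∀ j → g j ≡ - f j) → ∀ k → PmaxTraj f k ≡ PminTraj g k
PmaxTraj≡PminTraj-neg f g g≡ k =
  trans (reflect (f k) (maxUpTo f k))
        (sym (cong₂ (λ a b → a - + 2 ℤ.* b) (g≡ k) (minUpTo-neg f g g≡ k)))
  where
  reflect : ∀ a M → + 2 ℤ.* M - a ≡ - a - + 2 ℤ.* (- M)
  reflect = ℤ-Solver.solve-∀

-- PminTraj relative to a running minimum m already reached before time 0
pminFrom : ℤ → (ℕ → ℤ) → ℕ → ℤ
pminFrom m f k = f k - + 2 ℤ.* (m ⊓ minUpTo f k)

PminTraj≡pminFrom : ∀ f k → PminTraj f k ≡ pminFrom (f 0) f k
PminTraj≡pminFrom f k =
  cong (λ b → f k - + 2 ℤ.* b) (sym (ℤₚ.i≥j⇒i⊓j≡j (minUpTo≤head f k)))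

pminFrom-zero : ∀ m f → m ≤ℤ f 0 → pminFrom m f 0 ≡ f 0 - + 2 ℤ.* m
pminFrom-zero m f m≤f₀ = cong (λ b → f 0 - + 2 ℤ.* b) (ℤₚ.i≤j⇒i⊓j≡i m≤f₀)

pminFrom-suc : ∀ m f k → m ≤ℤ f 0 → pminFrom m f (suc k) ≡ pminFrom (m ⊓ f 1) (f ∘ suc) k
pminFrom-suc m f k m≤f₀ = cong (λ b → f (suc k) - + 2 ℤ.* b) (begin
  m ⊓ minUpTo f (suc k)      ≡⟨ cong (m ⊓_) (minUpTo-suc f k) ⟩
  m ⊓ (f 0 ⊓ X)              ≡⟨ ℤₚ.⊓-assoc m (f 0) X ⟨
  m ⊓ f 0 ⊓ X                ≡⟨ cong (_⊓ X) (ℤₚ.i≤j⇒i⊓j≡i m≤f₀) ⟩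
  m ⊓ X                      ≡⟨ cong (m ⊓_) (ℤₚ.i≥j⇒i⊓j≡j (minUpTo≤head (f ∘ suc) k)) ⟨
  m ⊓ (f 1 ⊓ X)              ≡⟨ ℤₚ.⊓-assoc m (f 1) X ⟨
  m ⊓ f 1 ⊓ X                ∎)
  where
  open ≡-Reasoning
  X = minUpTo (f ∘ suc) k

-- 𝒫_min read letter by letter; d is the height of the path above its running minimum
reflectAt : ℕ → Letter → Letter
reflectAt d       one = one
reflectAt zero    two = one
reflectAt (suc d) two = two

heightAfter : ℕ → Letter → ℕ
heightAfter d       one = suc d
heightAfter zero    two = zero
heightAfter (suc d) two = d

pminWord : ∀ {n} → ℕ → Word n → Word n
pminWord d []      = []
pminWord d (x ∷ w) = reflectAt d x ∷ pminWord (heightAfter d x) w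

-- after the step the path is at height t = step x + d above the old minimum,
-- and the new running minimum lies 0 ⊓ t above the old one
heightAfter-spec : ∀ d x → step x ℤ.+ + d ≡ + 0 ⊓ (step x ℤ.+ + d) ℤ.+ + heightAfter d x
heightAfter-spec d       one = refl
heightAfter-spec zero    two = refl
heightAfter-spec (suc d) two = refl

reflectAt-spec : ∀ d x → + heightAfter d x - + 0 ⊓ (step x ℤ.+ + d) ≡ step (reflectAt d x) ℤ.+ + d
reflectAt-spec d       one = ℤₚ.+-identityʳ _
reflectAt-spec zero    two = refl
reflectAt-spec (suc d) two = ℤₚ.+-identityʳ _

⊓-+-shift : ∀ m t → m ⊓ (m ℤ.+ t) ≡ m ℤ.+ (+ 0 ⊓ t)
⊓-+-shift m t = sym (trans (ℤₚ.mono-≤-distrib-⊓ (ℤₚ.+-monoʳ-≤ m) (+ 0) t)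
                           (cong (_⊓ (m ℤ.+ t)) (ℤₚ.+-identityʳ m)))

above⇒≤ : ∀ m d (f : ℕ → ℤ) → f 0 ≡ m ℤ.+ + d ℤ.+ + 0 → m ≤ℤ f 0
above⇒≤ m d f f₀≡ = ℤₚ.≤-trans (ℤₚ.i≤i+j m (+ d)) (ℤₚ.≤-reflexive (sym (trans f₀≡ (ℤₚ.+-identityʳ _))))

pminFrom-traj : ∀ {n} (w : Word n) m d f → (∀ k → f k ≡ m ℤ.+ + d ℤ.+ traj w k) →
                ∀ k → pminFrom m f k ≡ + d - m ℤ.+ traj (pminWord d w) k
pminFrom-traj w m d f f≡ zero = begin
  pminFrom m f 0                 ≡⟨ pminFrom-zero m f (above⇒≤ m d f (f≡ 0)) ⟩
  f 0 - + 2 ℤ.* m                ≡⟨ cong (_- + 2 ℤ.* m) (f≡ 0) ⟩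
  m ℤ.+ + d ℤ.+ + 0 - + 2 ℤ.* m  ≡⟨ rebase m (+ d) ⟩
  + d - m ℤ.+ + 0                ∎
  where
  open ≡-Reasoning
  rebase : ∀ m D → m ℤ.+ D ℤ.+ + 0 - + 2 ℤ.* m ≡ D - m ℤ.+ + 0
  rebase = ℤ-Solver.solve-∀
pminFrom-traj [] m d f f≡ (suc k) = begin
  pminFrom m f (suc k)            ≡⟨ pminFrom-suc m f k (above⇒≤ m d f (f≡ 0)) ⟩
  pminFrom (m ⊓ f 1) (f ∘ suc) k  ≡⟨ cong (λ m′ → pminFrom m′ (f ∘ suc) k) (ℤₚ.i≤j⇒i⊓j≡i m≤f₁) ⟩
  pminFrom m (f ∘ suc) k          ≡⟨ pminFrom-traj [] m d (f ∘ suc) f∘suc≡ k ⟩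
  + d - m ℤ.+ traj [] k           ≡⟨ cong (ℤ._+_ (+ d - m)) (traj-[] k) ⟩
  + d - m ℤ.+ + 0                 ∎
  where
  open ≡-Reasoning
  m≤f₁ : m ≤ℤ f 1
  m≤f₁ = above⇒≤ m d (f ∘ suc) (f≡ 1)
  f∘suc≡ : ∀ j → f (suc j) ≡ m ℤ.+ + d ℤ.+ traj [] j
  f∘suc≡ j = trans (f≡ (suc j)) (cong (ℤ._+_ (m ℤ.+ + d)) (sym (traj-[] j)))
pminFrom-traj (x ∷ w) m d f f≡ (suc k) = begin
  pminFrom m f (suc k)            ≡⟨ pminFrom-suc m f k (above⇒≤ m d f (f≡ 0)) ⟩
  pminFrom (m ⊓ f 1) (f ∘ suc) k  ≡⟨ cong (λ m″ → pminFrom m″ (f ∘ suc) k) newMin ⟩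
  pminFrom m′ (f ∘ suc) k         ≡⟨ pminFrom-traj w m′ d′ (f ∘ suc) f∘suc≡ k ⟩
  + d′ - m′ ℤ.+ T                 ≡⟨ regroup₁ (+ d′) m u T ⟩
  + d′ - u - m ℤ.+ T              ≡⟨ cong (λ a → a - m ℤ.+ T) (reflectAt-spec d x) ⟩
  step r ℤ.+ + d - m ℤ.+ T        ≡⟨ regroup₂ (step r) (+ d) m T ⟩
  + d - m ℤ.+ (step r ℤ.+ T)      ∎
  where
  open ≡-Reasoning
  t = step x ℤ.+ + d
  u = + 0 ⊓ t
  m′ = m ℤ.+ u
  d′ = heightAfter d x
  r = reflectAt d x
  T = traj (pminWord d′ w) k
  regroup₀ : ∀ m D s T → m ℤ.+ D ℤ.+ (s ℤ.+ T) ≡ m ℤ.+ (s ℤ.+ D) ℤ.+ T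
  regroup₀ = ℤ-Solver.solve-∀
  regroup₁ : ∀ D′ m u T → D′ - (m ℤ.+ u) ℤ.+ T ≡ D′ - u - m ℤ.+ T
  regroup₁ = ℤ-Solver.solve-∀
  regroup₂ : ∀ s D m T → s ℤ.+ D - m ℤ.+ T ≡ D - m ℤ.+ (s ℤ.+ T)
  regroup₂ = ℤ-Solver.solve-∀
  newMin : m ⊓ f 1 ≡ m′
  newMin = begin
    m ⊓ f 1                                  ≡⟨ cong (m ⊓_) (f≡ 1) ⟩
    m ⊓ (m ℤ.+ + d ℤ.+ (step x ℤ.+ + 0))     ≡⟨ cong (m ⊓_) (trans (regroup₀ m (+ d) (step x) (+ 0)) (ℤₚ.+-identityʳ _)) ⟩
    m ⊓ (m ℤ.+ t)                            ≡⟨ ⊓-+-shift m t ⟩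
    m′                                       ∎
  f∘suc≡ : ∀ j → f (suc j) ≡ m′ ℤ.+ + d′ ℤ.+ traj w j
  f∘suc≡ j = begin
    f (suc j)                          ≡⟨ f≡ (suc j) ⟩
    m ℤ.+ + d ℤ.+ (step x ℤ.+ traj w j) ≡⟨ regroup₀ m (+ d) (step x) (traj w j) ⟩
    m ℤ.+ t ℤ.+ traj w j               ≡⟨ cong (λ a → m ℤ.+ a ℤ.+ traj w j) (heightAfter-spec d x) ⟩
    m ℤ.+ (u ℤ.+ + d′) ℤ.+ traj w j    ≡⟨ cong (ℤ._+ traj w j) (ℤₚ.+-assoc m u (+ d′)) ⟨
    m′ ℤ.+ + d′ ℤ.+ traj w j           ∎

PminTraj-traj : ∀ {n} (w : Word n) k → PminTraj (traj w) k ≡ + 0 ℤ.+ traj (pminWord 0 w) k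
PminTraj-traj w k = trans (PminTraj≡pminFrom (traj w) k)
  (pminFrom-traj w (+ 0) 0 (traj w) (λ j → sym (ℤₚ.+-identityˡ (traj w j))) k)

Pmin≡pminWord : ∀ {n} (w : Word n) → Pmin w ≡ pminWord 0 w
Pmin≡pminWord w = wordOf-traj (pminWord 0 w) (+ 0) (PminTraj (traj w)) (PminTraj-traj w)

Pmax≡pminWord-pr : ∀ {n} (w : Word n) → Pmax w ≡ pminWord 0 (pr w)
Pmax≡pminWord-pr w = wordOf-traj (pminWord 0 (pr w)) (+ 0) (PmaxTraj (traj w)) λ k →
  trans (PmaxTraj≡PminTraj-neg (traj w) (traj (pr w)) (traj-pr w) k) (PminTraj-traj (pr w) k)

H-reflectAt : ∀ d x y → H (reflectAt d x) (reflectAt (heightAfter d x) y) ≡ H x y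
H-reflectAt d       one one = refl
H-reflectAt d       one two = refl
H-reflectAt zero    two one = refl
H-reflectAt zero    two two = refl
H-reflectAt (suc d) two y   = refl

D-pminWord : ∀ {n} d (w : Word n) → D (pminWord d w) ≡ D w
D-pminWord d []                         = refl
D-pminWord d (x ∷ [])                   = refl
D-pminWord {suc (suc m)} d (x ∷ y ∷ r) =
  cong₂ _+_ (cong (suc m *_) (H-reflectAt d x y)) (D-pminWord (heightAfter d x) (y ∷ r))

LeadingOnes : ∀ {n} → ℕ → Word n → Set
LeadingOnes zero    w       = ⊤
LeadingOnes (suc k) []      = ⊤
LeadingOnes (suc k) (x ∷ w) = x ≡ one × LeadingOnes k w

pminWord-pr-leadingOnes : ∀ {n} k (w : Word n) → LeadingOnes k w → LeadingOnes (suc k) (pminWord 0 (pr w))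
pminWord-pr-leadingOnes zero    []          _         = tt
pminWord-pr-leadingOnes zero    (one ∷ w)   _         = refl , tt
pminWord-pr-leadingOnes zero    (two ∷ w)   _         = refl , tt
pminWord-pr-leadingOnes (suc k) []          _         = tt
pminWord-pr-leadingOnes (suc k) (.one ∷ w)  (refl , p) = refl , pminWord-pr-leadingOnes k w p

iter-Pmax-leadingOnes : ∀ {n} k (w : Word n) → LeadingOnes k (iter k Pmax w)
iter-Pmax-leadingOnes zero    w = tt
iter-Pmax-leadingOnes (suc k) w =
  subst (LeadingOnes (suc k)) (sym (Pmax≡pminWord-pr (iter k Pmax w)))
        (pminWord-pr-leadingOnes k _ (iter-Pmax-leadingOnes k w))

leadingOnes⇒allOne : ∀ {n k} (w : Word n) → n ≤ k → LeadingOnes k w → w ≡ allOne n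
leadingOnes⇒allOne []                 _       _          = refl
leadingOnes⇒allOne {k = suc k} (.one ∷ w) (s≤s n≤k) (refl , p) = cong (one ∷_) (leadingOnes⇒allOne w n≤k p)

isTwo : Letter → ℕ
isTwo one = 0
isTwo two = 1

H-swapL : ∀ x y → H x y + isTwo x ≡ H (swapL x) (swapL y) + isTwo y
H-swapL one one = refl
H-swapL one two = refl
H-swapL two one = refl
H-swapL two two = refl

countMinus-∷ : ∀ {n} x (w : Word n) → countMinus (x ∷ w) ≡ isTwo x + countMinus w
countMinus-∷ one w = refl
countMinus-∷ two w = refl

D-pr : ∀ {n} x (w : Word n) → D (x ∷ w) + suc n * isTwo x ≡ D (pr (x ∷ w)) + countMinus (x ∷ w)
D-pr one [] = refl
D-pr two [] = refl
D-pr {suc m} x (y ∷ r) = begin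
  suc m * H x y + D (y ∷ r) + suc (suc m) * isTwo x
    ≡⟨ regroup₁ m (H x y) (D (y ∷ r)) (isTwo x) ⟩
  suc m * (H x y + isTwo x) + D (y ∷ r) + isTwo x
    ≡⟨ cong (λ h → suc m * h + D (y ∷ r) + isTwo x) (H-swapL x y) ⟩
  suc m * (H x′ y′ + isTwo y) + D (y ∷ r) + isTwo x
    ≡⟨ regroup₂ m (H x′ y′) (isTwo y) (D (y ∷ r)) (isTwo x) ⟩
  suc m * H x′ y′ + (D (y ∷ r) + suc m * isTwo y) + isTwo x
    ≡⟨ cong (λ e → suc m * H x′ y′ + e + isTwo x) (D-pr y r) ⟩
  suc m * H x′ y′ + (D (pr (y ∷ r)) + countMinus (y ∷ r)) + isTwo x
    ≡⟨ regroup₃ (suc m * H x′ y′) (D (pr (y ∷ r))) (countMinus (y ∷ r)) (isTwo x) ⟩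
  suc m * H x′ y′ + D (pr (y ∷ r)) + (isTwo x + countMinus (y ∷ r))
    ≡⟨ cong (_+_ (suc m * H x′ y′ + D (pr (y ∷ r)))) (countMinus-∷ x (y ∷ r)) ⟨
  D (pr (x ∷ y ∷ r)) + countMinus (x ∷ y ∷ r) ∎
  where
  open ≡-Reasoning
  x′ = swapL x
  y′ = swapL y
  regroup₁ : ∀ m h e t → suc m * h + e + suc (suc m) * t ≡ suc m * (h + t) + e + t
  regroup₁ = ℕ-Solver.solve-∀
  regroup₂ : ∀ m h t e s → suc m * (h + t) + e + s ≡ suc m * h + (e + suc m * t) + s
  regroup₂ = ℕ-Solver.solve-∀
  regroup₃ : ∀ a b c s → a + (b + c) + s ≡ a + b + (s + c)
  regroup₃ = ℕ-Solver.solve-∀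

D-pr-nonnegative : ∀ {n} (w : Word n) → ((k : ℕ) → k ≤ n → + 0 ≤ℤ traj w k) →
                   D (pr w) + countMinus w ≡ D w
D-pr-nonnegative []        _ = refl
D-pr-nonnegative (two ∷ w) nonneg with nonneg 1 (s≤s z≤n)
... | ()
D-pr-nonnegative {suc n} (one ∷ w) _ =
  trans (sym (D-pr one w)) (trans (cong (_+_ (D (one ∷ w))) (ℕₚ.*-zeroʳ (suc n))) (ℕₚ.+-identityʳ _))

proposition6p1 : (n : ℕ) → 1 ≤ n →
    ((w : Word n) → D (Pmin w) ≡ D w)
    × ((w : Word n) → ((k : ℕ) → k ≤ n → + 0 ≤ℤ traj w k) → D (pr w) + countMinus w ≡ D w)
    × ((w : Word n) → ∃ λ m₀ → (m : ℕ) → m₀ ≤ m → iter m Pmax w ≡ allOne n)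
proposition6p1 n _ =
    (λ w → trans (cong D (Pmin≡pminWord w)) (D-pminWord 0 w))
  , D-pr-nonnegative
  , λ w → n , λ m n≤m → leadingOnes⇒allOne (iter m Pmax w) n≤m (iter-Pmax-leadingOnes m w)
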